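{- For all integers $1\le k<n$, $$\binom{2n-k-1}{n}=\frac{n-k}{n}\sum_{i=k}^n(-1)^{i-k}\binom{i}{k}\binom{2n}{n-i}.$$ -}

module Defs where

open import Data.Nat as ℕ using (ℕ; zero; suc)
open import Data.Nat.Combinatorics using (_C_)
open import Data.Integer using (ℤ; +_; _+_; _*_; -_)

negOnePow : ℕ → ℤ
negOnePow zero = + 1
negOnePow (suc m) = - negOnePow m

sumFrom : ℕ → ℕ → (ℕ → ℤ) → ℤ
sumFrom a zero f = + 0
sumFrom a (suc len) f = f a + sumFrom (suc a) len f

rhsSum : ℕ → ℕ → ℤ
rhsSum n k = sumFrom k (suc (n ℕ.∸ k))
  (λ i → negOnePow (i ℕ.∸ k) * (+ (i C k)) * (+ ((2 ℕ.* n) C (n ℕ.∸ i))))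

-- Write n = k + 1 + d. The sum is the coefficient of x^(d+1) in
-- (1 + x)^(-(k+1)) (1 + x)^(2n) = (1 + x)^(2n-k-1), i.e. C(2n-k-1, d+1);
-- this convolution identity is proved by induction on the exponent and the index,
-- peeling off one factor (1 + x) at a time with Pascal's rule. What remains,
-- n C(2n-k-1, n) = (n-k) C(2n-k-1, n-k), is two absorption steps around the
-- symmetry C(a+d, a) = C(a+d, d).
module Submission where

open import Defs
open import Data.Nat as ℕ using (ℕ; _≤_; _<_; _∸_; zero; suc; z≤n; s≤s)
open import Data.Nat.Combinatorics
  using (_C_; nCk≡nC[n∸k]; nCn≡1; nCk+nC[k+1]≡[n+1]C[k+1]; nC1≡n; k>n⇒nCk≡0)
open import Data.Integer using (ℤ; +_; _*_; _+_; -_)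
open import Relation.Binary.PropositionalEquality
  using (_≡_; refl; sym; trans; cong; cong₂; subst; module ≡-Reasoning)
import Data.Nat.Properties as ℕ
import Data.Integer.Properties as ℤ
open import Algebra.Properties.AbelianGroup ℤ.+-0-abelianGroup using (∙-cancelʳ)
import Data.Integer.Tactic.RingSolver as ℤ-Solver
import Data.Nat.Tactic.RingSolver as ℕ-Solver

open ≡-Reasoning

nC0≡1 : ∀ n → n C 0 ≡ 1
nC0≡1 n = trans (nCk≡nC[n∸k] (z≤n {n})) (nCn≡1 n)

pascalℤ : ∀ n k → + (suc n C suc k) ≡ + (n C suc k) + + (n C k)
pascalℤ n k = trans (cong +_ (sym (nCk+nC[k+1]≡[n+1]C[k+1] n k))) (ℤ.+-comm (+ (n C k)) (+ (n C suc k)))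

pascal-step : ∀ {x y} n k → y ≡ + (n C k) → x + y ≡ + (suc n C suc k) → x ≡ + (n C suc k)
pascal-step {x} n k refl x+y≡ = ∙-cancelʳ (+ (n C k)) x _ (trans x+y≡ (pascalℤ n k))

[1+k]*[1+n]C[1+k]≡[1+n]*nCk : ∀ n k → suc k ℕ.* (suc n C suc k) ≡ suc n ℕ.* (n C k)
[1+k]*[1+n]C[1+k]≡[1+n]*nCk zero zero = refl
[1+k]*[1+n]C[1+k]≡[1+n]*nCk zero (suc k) = begin
  suc (suc k) ℕ.* (1 C suc (suc k))
    ≡⟨ cong (suc (suc k) ℕ.*_) (k>n⇒nCk≡0 {1} {suc (suc k)} (s≤s (s≤s z≤n))) ⟩
  suc (suc k) ℕ.* 0                 ≡⟨ ℕ.*-zeroʳ (suc (suc k)) ⟩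
  0                                 ≡⟨ cong (1 ℕ.*_) (k>n⇒nCk≡0 {0} {suc k} (s≤s z≤n)) ⟨
  1 ℕ.* (0 C suc k)                 ∎
[1+k]*[1+n]C[1+k]≡[1+n]*nCk (suc n) zero = begin
  1 ℕ.* (suc (suc n) C 1)  ≡⟨ ℕ.*-identityˡ _ ⟩
  suc (suc n) C 1          ≡⟨ nC1≡n (suc (suc n)) ⟩
  suc (suc n)              ≡⟨ ℕ.*-identityʳ (suc (suc n)) ⟨
  suc (suc n) ℕ.* 1        ≡⟨ cong (suc (suc n) ℕ.*_) (nC0≡1 (suc n)) ⟨
  suc (suc n) ℕ.* (suc n C 0) ∎
[1+k]*[1+n]C[1+k]≡[1+n]*nCk (suc n) (suc k) = begin
  suc (suc k) ℕ.* (suc (suc n) C suc (suc k))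
    ≡⟨ cong (suc (suc k) ℕ.*_) (nCk+nC[k+1]≡[n+1]C[k+1] (suc n) (suc k)) ⟨
  suc (suc k) ℕ.* (a ℕ.+ b)
    ≡⟨ distribute k a b ⟩
  a ℕ.+ suc k ℕ.* a ℕ.+ suc (suc k) ℕ.* b
    ≡⟨ cong₂ (λ x y → a ℕ.+ x ℕ.+ y)
         ([1+k]*[1+n]C[1+k]≡[1+n]*nCk n k) ([1+k]*[1+n]C[1+k]≡[1+n]*nCk n (suc k)) ⟩
  a ℕ.+ suc n ℕ.* (n C k) ℕ.+ suc n ℕ.* (n C suc k)
    ≡⟨ collect n a (n C k) (n C suc k) ⟩
  a ℕ.+ suc n ℕ.* (n C k ℕ.+ n C suc k)
    ≡⟨ cong (λ x → a ℕ.+ suc n ℕ.* x) (nCk+nC[k+1]≡[n+1]C[k+1] n k) ⟩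
  suc (suc n) ℕ.* a
    ∎
  where
  a = suc n C suc k
  b = suc n C suc (suc k)
  distribute : ∀ k a b → suc (suc k) ℕ.* (a ℕ.+ b) ≡ a ℕ.+ suc k ℕ.* a ℕ.+ suc (suc k) ℕ.* b
  distribute = ℕ-Solver.solve-∀
  collect : ∀ n a x y → a ℕ.+ suc n ℕ.* x ℕ.+ suc n ℕ.* y ≡ a ℕ.+ suc n ℕ.* (x ℕ.+ y)
  collect = ℕ-Solver.solve-∀

C-swap : ∀ a d → (a ℕ.+ d) C a ≡ (a ℕ.+ d) C d
C-swap a d = trans (nCk≡nC[n∸k] (ℕ.m≤m+n a d)) (cong ((a ℕ.+ d) C_) (ℕ.m+n∸m≡n a d))

absorption-swap : ∀ a d → suc a ℕ.* (suc (a ℕ.+ d) C suc a) ≡ suc d ℕ.* (suc (a ℕ.+ d) C suc d)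
absorption-swap a d = begin
  suc a ℕ.* (suc (a ℕ.+ d) C suc a)   ≡⟨ [1+k]*[1+n]C[1+k]≡[1+n]*nCk (a ℕ.+ d) a ⟩
  suc (a ℕ.+ d) ℕ.* ((a ℕ.+ d) C a)   ≡⟨ cong (suc (a ℕ.+ d) ℕ.*_) (C-swap a d) ⟩
  suc (a ℕ.+ d) ℕ.* ((a ℕ.+ d) C d)   ≡⟨ [1+k]*[1+n]C[1+k]≡[1+n]*nCk (a ℕ.+ d) d ⟨
  suc d ℕ.* (suc (a ℕ.+ d) C suc d)   ∎

-- conv h g q is the coefficient of x^q in (Σ h t x^t) (Σ g s x^s).
conv : (ℕ → ℤ) → (ℕ → ℤ) → ℕ → ℤ
conv h g zero = h 0 * g 0
conv h g (suc q) = h 0 * g (suc q) + conv (λ t → h (suc t)) g q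

conv-congˡ : ∀ {h h′} g q → (∀ t → h t ≡ h′ t) → conv h g q ≡ conv h′ g q
conv-congˡ g zero h≡h′ = cong (_* g 0) (h≡h′ 0)
conv-congˡ g (suc q) h≡h′ =
  cong₂ _+_ (cong (_* g (suc q)) (h≡h′ 0)) (conv-congˡ g q (λ t → h≡h′ (suc t)))

conv-zeroˡ : ∀ {h} g q → (∀ t → h t ≡ + 0) → conv h g q ≡ + 0
conv-zeroˡ g q h≡0 = trans (conv-congˡ g q h≡0) (zeros q)
  where
  zeros : ∀ q → conv (λ _ → + 0) g q ≡ + 0
  zeros zero = refl
  zeros (suc q) = trans (ℤ.+-identityˡ _) (zeros q)

conv-+ˡ : ∀ h₁ h₂ g q → conv h₁ g q + conv h₂ g q ≡ conv (λ t → h₁ t + h₂ t) g q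
conv-+ˡ h₁ h₂ g zero = sym (ℤ.*-distribʳ-+ (g 0) (h₁ 0) (h₂ 0))
conv-+ˡ h₁ h₂ g (suc q) = begin
  (h₁ 0 * g (suc q) + conv (λ t → h₁ (suc t)) g q)
    + (h₂ 0 * g (suc q) + conv (λ t → h₂ (suc t)) g q)
    ≡⟨ interchange (h₁ 0 * g (suc q)) _ (h₂ 0 * g (suc q)) _ ⟩
  (h₁ 0 * g (suc q) + h₂ 0 * g (suc q))
    + (conv (λ t → h₁ (suc t)) g q + conv (λ t → h₂ (suc t)) g q)
    ≡⟨ cong₂ _+_ (sym (ℤ.*-distribʳ-+ (g (suc q)) (h₁ 0) (h₂ 0))) (conv-+ˡ _ _ g q) ⟩
  (h₁ 0 + h₂ 0) * g (suc q) + conv (λ t → h₁ (suc t) + h₂ (suc t)) g q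
    ∎
  where
  interchange : ∀ a b c d → (a + b) + (c + d) ≡ (a + c) + (b + d)
  interchange = ℤ-Solver.solve-∀

conv-[1+x]ˡ : ∀ h g q →
  conv h g (suc q) + conv h g q ≡ h 0 * g (suc q) + conv (λ t → h (suc t) + h t) g q
conv-[1+x]ˡ h g q = begin
  (h 0 * g (suc q) + conv (λ t → h (suc t)) g q) + conv h g q
    ≡⟨ ℤ.+-assoc (h 0 * g (suc q)) _ _ ⟩
  h 0 * g (suc q) + (conv (λ t → h (suc t)) g q + conv h g q)
    ≡⟨ cong (λ c → h 0 * g (suc q) + c) (conv-+ˡ _ h g q) ⟩
  h 0 * g (suc q) + conv (λ t → h (suc t) + h t) g q
    ∎

-- invPowerCoeff m is the coefficient sequence of (1 + x)^(-(m+1)).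
invPowerCoeff : ℕ → ℕ → ℤ
invPowerCoeff m t = negOnePow t * + ((t ℕ.+ m) C m)

invPowerCoeff-zero : ∀ m → invPowerCoeff m 0 ≡ + 1
invPowerCoeff-zero m = cong (λ c → + 1 * + c) (nCn≡1 m)

invPowerCoeff-pascal : ∀ m t →
  invPowerCoeff (suc m) (suc t) + invPowerCoeff (suc m) t ≡ invPowerCoeff m (suc t)
invPowerCoeff-pascal m t = begin
  - e * + ((suc t ℕ.+ suc m) C suc m) + e * + ((t ℕ.+ suc m) C suc m)
    ≡⟨ cong₂ (λ x y → - e * + (x C suc m) + e * + (y C suc m))
         (cong suc (ℕ.+-suc t m)) (ℕ.+-suc t m) ⟩
  - e * + (suc s C suc m) + e * + (s C suc m)
    ≡⟨ cong (λ c → - e * c + e * + (s C suc m)) (pascalℤ s m) ⟩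
  - e * (+ (s C suc m) + + (s C m)) + e * + (s C suc m)
    ≡⟨ cancel e _ _ ⟩
  - e * + (s C m)
    ∎
  where
  e = negOnePow t
  s = suc t ℕ.+ m
  cancel : ∀ e a b → - e * (a + b) + e * a ≡ - e * b
  cancel = ℤ-Solver.solve-∀

invPowerCoeff-pascal₀ : ∀ t → invPowerCoeff 0 (suc t) + invPowerCoeff 0 t ≡ + 0
invPowerCoeff-pascal₀ t = begin
  - e * + ((suc t ℕ.+ 0) C 0) + e * + ((t ℕ.+ 0) C 0)
    ≡⟨ cong₂ (λ x y → - e * + x + e * + y) (nC0≡1 (suc t ℕ.+ 0)) (nC0≡1 (t ℕ.+ 0)) ⟩
  - e * + 1 + e * + 1
    ≡⟨ cancel e ⟩
  + 0
    ∎
  where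
  e = negOnePow t
  cancel : ∀ e → - e * + 1 + e * + 1 ≡ + 0
  cancel = ℤ-Solver.solve-∀

conv-invPowerCoeff-[1+x] : ∀ m g q →
  conv (invPowerCoeff (suc m)) g (suc q) + conv (invPowerCoeff (suc m)) g q
    ≡ conv (invPowerCoeff m) g (suc q)
conv-invPowerCoeff-[1+x] m g q = begin
  conv (invPowerCoeff (suc m)) g (suc q) + conv (invPowerCoeff (suc m)) g q
    ≡⟨ conv-[1+x]ˡ (invPowerCoeff (suc m)) g q ⟩
  invPowerCoeff (suc m) 0 * g (suc q)
    + conv (λ t → invPowerCoeff (suc m) (suc t) + invPowerCoeff (suc m) t) g q
    ≡⟨ cong₂ _+_ (cong (_* g (suc q)) (trans (invPowerCoeff-zero (suc m)) (sym (invPowerCoeff-zero m))))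
                 (conv-congˡ g q (invPowerCoeff-pascal m)) ⟩
  conv (invPowerCoeff m) g (suc q)
    ∎

conv-invPowerCoeff₀-[1+x] : ∀ g q →
  conv (invPowerCoeff 0) g (suc q) + conv (invPowerCoeff 0) g q ≡ g (suc q)
conv-invPowerCoeff₀-[1+x] g q = begin
  conv (invPowerCoeff 0) g (suc q) + conv (invPowerCoeff 0) g q
    ≡⟨ conv-[1+x]ˡ (invPowerCoeff 0) g q ⟩
  invPowerCoeff 0 0 * g (suc q) + conv (λ t → invPowerCoeff 0 (suc t) + invPowerCoeff 0 t) g q
    ≡⟨ cong₂ _+_ (cong (_* g (suc q)) (invPowerCoeff-zero 0))
                 (conv-zeroˡ g q invPowerCoeff-pascal₀) ⟩
  + 1 * g (suc q) + + 0
    ≡⟨ trans (ℤ.+-identityʳ _) (ℤ.*-identityˡ _) ⟩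
  g (suc q)
    ∎

binomialℤ : ℕ → ℕ → ℤ
binomialℤ N s = + (N C s)

conv-invPowerCoeff-binomial : ∀ {N} m r → N ≡ suc (m ℕ.+ r) →
  ∀ q → conv (invPowerCoeff m) (binomialℤ N) q ≡ + (r C q)
conv-invPowerCoeff-binomial {N} m r _ zero = begin
  invPowerCoeff m 0 * + (N C 0) ≡⟨ cong₂ (λ a c → a * + c) (invPowerCoeff-zero m) (nC0≡1 N) ⟩
  + 1                           ≡⟨ cong +_ (nC0≡1 r) ⟨
  + (r C 0)                     ∎
conv-invPowerCoeff-binomial {N} zero r N≡ (suc q) =
  pascal-step r q (conv-invPowerCoeff-binomial zero r N≡ q)
    (trans (conv-invPowerCoeff₀-[1+x] (binomialℤ N) q) (cong (λ M → + (M C suc q)) N≡))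
conv-invPowerCoeff-binomial {N} (suc m) r N≡ (suc q) =
  pascal-step r q (conv-invPowerCoeff-binomial (suc m) r N≡ q)
    (trans (conv-invPowerCoeff-[1+x] m (binomialℤ N) q)
      (conv-invPowerCoeff-binomial m (suc r) (trans N≡ (cong suc (sym (ℕ.+-suc m r)))) (suc q)))

sumFrom-conv : ∀ a L F h g → (∀ t → t ≤ L → F (t ℕ.+ a) ≡ h t * g (L ∸ t)) →
  sumFrom a (suc L) F ≡ conv h g L
sumFrom-conv a zero F h g F≡ = trans (ℤ.+-identityʳ (F a)) (F≡ 0 z≤n)
sumFrom-conv a (suc L) F h g F≡ = cong₂ _+_ (F≡ 0 z≤n)
  (sumFrom-conv (suc a) L F (λ t → h (suc t)) g
    (λ t t≤L → trans (cong F (ℕ.+-suc t a)) (F≡ (suc t) (s≤s t≤L))))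

module _ (k d : ℕ) where

  private
    n X : ℕ
    n = suc (k ℕ.+ d)
    X = n ℕ.+ d

  2n≡1+k+X : 2 ℕ.* n ≡ suc (k ℕ.+ X)
  2n≡1+k+X = expand k d
    where
    expand : ∀ k d → 2 ℕ.* suc (k ℕ.+ d) ≡ suc (k ℕ.+ (suc (k ℕ.+ d) ℕ.+ d))
    expand = ℕ-Solver.solve-∀

  2n∸k∸1≡X : 2 ℕ.* n ∸ k ∸ 1 ≡ X
  2n∸k∸1≡X = trans (cong (λ m → m ∸ k ∸ 1) (trans 2n≡1+k+X (sym (ℕ.+-suc k X))))
                   (cong (_∸ 1) (ℕ.m+n∸m≡n k (suc X)))

  n∸k≡1+d : n ∸ k ≡ suc d
  n∸k≡1+d = trans (cong (_∸ k) (sym (ℕ.+-suc k d))) (ℕ.m+n∸m≡n k (suc d))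

  rhsSum≡XC[1+d] : rhsSum n k ≡ + (X C suc d)
  rhsSum≡XC[1+d] = begin
    sumFrom k (suc (n ∸ k)) F
      ≡⟨ cong (λ L → sumFrom k (suc L) F) n∸k≡1+d ⟩
    sumFrom k (suc (suc d)) F
      ≡⟨ sumFrom-conv k (suc d) F (invPowerCoeff k) (binomialℤ (2 ℕ.* n)) F≡ ⟩
    conv (invPowerCoeff k) (binomialℤ (2 ℕ.* n)) (suc d)
      ≡⟨ conv-invPowerCoeff-binomial k X 2n≡1+k+X (suc d) ⟩
    + (X C suc d)
      ∎
    where
    F : ℕ → ℤ
    F i = negOnePow (i ∸ k) * + (i C k) * + ((2 ℕ.* n) C (n ∸ i))
    n∸[t+k]≡1+d∸t : ∀ t → n ∸ (t ℕ.+ k) ≡ suc d ∸ t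
    n∸[t+k]≡1+d∸t t = begin
      n ∸ (t ℕ.+ k) ≡⟨ cong (n ∸_) (ℕ.+-comm t k) ⟩
      n ∸ (k ℕ.+ t) ≡⟨ ℕ.∸-+-assoc n k t ⟨
      n ∸ k ∸ t     ≡⟨ cong (_∸ t) n∸k≡1+d ⟩
      suc d ∸ t     ∎
    F≡ : ∀ t → t ≤ suc d →
      F (t ℕ.+ k) ≡ invPowerCoeff k t * binomialℤ (2 ℕ.* n) (suc d ∸ t)
    F≡ t _ = cong₂ (λ u v → negOnePow u * + ((t ℕ.+ k) C k) * + ((2 ℕ.* n) C v))
      (ℕ.m+n∸n≡m t k) (n∸[t+k]≡1+d∸t t)

  identity-at-1+k+d : + n * + ((2 ℕ.* n ∸ k ∸ 1) C n) ≡ + (n ∸ k) * rhsSum n k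
  identity-at-1+k+d = begin
    + n * + ((2 ℕ.* n ∸ k ∸ 1) C n) ≡⟨ cong (λ m → + n * + (m C n)) 2n∸k∸1≡X ⟩
    + n * + (X C n)                 ≡⟨ ℤ.pos-* n (X C n) ⟨
    + (n ℕ.* (X C n))               ≡⟨ cong +_ (absorption-swap (k ℕ.+ d) d) ⟩
    + (suc d ℕ.* (X C suc d))       ≡⟨ ℤ.pos-* (suc d) (X C suc d) ⟩
    + suc d * + (X C suc d)         ≡⟨ cong₂ (λ m s → + m * s) n∸k≡1+d rhsSum≡XC[1+d] ⟨
    + (n ∸ k) * rhsSum n k          ∎

mainTheorem18 : (n k : ℕ) → 1 ≤ k → k < n →
    (+ n) * (+ (((2 ℕ.* n) ∸ k ∸ 1) C n)) ≡ (+ (n ∸ k)) * rhsSum n k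
mainTheorem18 n k _ k<n =
  subst (λ n → + n * + ((2 ℕ.* n ∸ k ∸ 1) C n) ≡ + (n ∸ k) * rhsSum n k)
    (ℕ.m+[n∸m]≡n k<n) (identity-at-1+k+d k (n ∸ suc k))
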